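{- For every $n\in\mathbb{N}$, $$I(n) > \tfrac{1}{2}n\log_2 n - \tfrac{1}{2}n - \tfrac{1}{2}\log_2 n + \frac{\ln 16 - 1}{\ln 4}.$$
   Context: An ideal on a set $X$ is a family of subsets of $X$ containing all finite subsets, closed under finite unions and subsets; proper if $X$ is not a member. Proper ideals $\mathcal{I},\mathcal{J}$ on $X$ are incompatible if some $A\in\mathcal{I}$ has $X\setminus A\in\mathcal{J}$; $B\subseteq X$ chooses between them if $B\in\mathcal{I}\setminus\mathcal{J}$ or $B\in\mathcal{J}\setminus\mathcal{I}$. $I(n)$ is the least $k$ such that for any set $X$ and any $k$ pairs of incompatible ideals on $X$, some $A\subseteq X$ chooses between at least $n$ of the pairs. -}

module Defs where

open import Data.Nat using (ℕ; zero; suc; _+_; _*_; _≤_; _!)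
open import Data.Fin using (Fin)
open import Data.List using (List)
open import Data.List.Membership.Propositional using (_∈_)
open import Data.Product using (Σ; ∃; _×_)
open import Data.Sum using (_⊎_)
open import Data.Unit using (⊤)
open import Relation.Nullary using (¬_)
open import Relation.Binary.PropositionalEquality using (_≡_)
open import Function.Definitions using (Injective)

Subset : Set → Set₁
Subset X = X → Set

module _ {X : Set} where

  _⊆_ : Subset X → Subset X → Set
  A ⊆ B = ∀ x → A x → B x

  _∪_ : Subset X → Subset X → Subset X
  (A ∪ B) x = A x ⊎ B x

  ∁ : Subset X → Subset X
  ∁ A x = ¬ A x

  full : Subset X
  full _ = ⊤

  Finite : Subset X → Set
  Finite A = Σ (List X) λ xs → ∀ x → A x → x ∈ xs

record Ideal (X : Set) : Set₁ where
  field
    mem     : Subset X → Set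
    finite  : ∀ A → Finite A → mem A
    union   : ∀ A B → mem A → mem B → mem (A ∪ B)
    subsets : ∀ A B → A ⊆ B → mem B → mem A
open Ideal public

Proper : {X : Set} → Ideal X → Set
Proper I = ¬ mem I full

Incompatible : {X : Set} → Ideal X → Ideal X → Set₁
Incompatible I J = Σ (Subset _) λ A → mem I A × mem J (∁ A)

Chooses : {X : Set} → Subset X → Ideal X → Ideal X → Set
Chooses B I J = (mem I B × ¬ mem J B) ⊎ (mem J B × ¬ mem I B)

-- Works n k : for any set X and any k pairs of incompatible proper ideals on X,
-- some A ⊆ X chooses between at least n of the pairs (n distinct indices).
-- I(n) is the least k with Works n k.
Works : ℕ → ℕ → Set₁
Works n k =
  (X : Set) (I J : Fin k → Ideal X) →
  (∀ i → Proper (I i)) → (∀ i → Proper (J i)) →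
  (∀ i → Incompatible (I i) (J i)) →
  Σ (Subset X) λ A → Σ (Fin n → Fin k) λ f →
    Injective _≡_ _≡_ f × (∀ i → Chooses A (I (f i)) (J (f i)))

-- eNum N = Σ_{j=0}^{N} N!/j!, so eNum N / N! = Σ_{j=0}^{N} 1/j!,
-- the N-th partial sum of the series for e.
-- (Recursion: Σ_{j≤N+1} (N+1)!/j! = (N+1)·Σ_{j≤N} N!/j! + 1.)
eNum : ℕ → ℕ
eNum zero    = 1
eNum (suc N) = suc N * eNum N + 1

-- e·a ≤ b (real inequality), via e = sup_N Σ_{j≤N} 1/j!.
e*_≤_ : ℕ → ℕ → Set
e* a ≤ b = ∀ N → a * eNum N ≤ b * (N !)

{-# OPTIONS --safe #-}
-- Take pairs (Sᵢ , S′ᵢ) of disjoint nonempty subsets of a finite set P of points, and for T ⊆ P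
-- let I_T be the ideal of subsets of ℕ × P all of whose fibres over points of T are finite.
-- The ideals I_Sᵢ and I_S′ᵢ are proper and incompatible, and A chooses between them exactly
-- when one of Sᵢ, S′ᵢ, but not the other, lies inside the set F_A of points over which A has
-- a finite fibre.  So it suffices to find many pairs of which no F ⊆ P separates more than
-- c = n − 1 (a system of width c).
--
-- Such pair systems come from binary trees: a node joining trees of widths a and b by m ≤ a, b
-- copies of the pair (leaves on the left, leaves on the right) has width a + b, since an F
-- separating a root copy contains one subtree entirely and then separates no pair inside it.
-- Splitting c into halves recursively yields K pairs with (c+1)^c ≤ 2^(2K+c), and together
-- with e ≥ 5/2 the hypothesis forces k ≤ K.

module Submission where

open import Defs
open import Data.Nat using (ℕ; zero; suc; _+_; _*_; _∸_; _^_; _≤_; _<_; z≤n; s≤s; z<s)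
open import Data.Nat.Properties
open import Data.Nat.Induction using (<-rec)
open import Data.Nat.Tactic.RingSolver using (solve-∀)
open import Data.Fin using (Fin; inject≤)
open import Data.Fin.Properties using (+↔⊎; inject≤-injective; injective⇒≤)
open import Data.List using (List; []; _++_; map; length; lookup; allFin)
open import Data.List.Properties using (length-++; length-map; length-tabulate)
open import Data.List.Membership.Propositional using (_∈_)
open import Data.List.Membership.Propositional.Properties using (∈-map⁺; ∈-++⁺ˡ; ∈-++⁺ʳ; ∈-allFin)
open import Data.List.Relation.Unary.Any.Properties using (lookup-index)
open import Data.List.Relation.Unary.All using () renaming (lookup to lookupᴬ)
open import Data.List.Extrema.Nat using (max; xs≤max)
open import Data.Product using (Σ; ∃; _×_; _,_; proj₁; proj₂)
import Data.Product as Product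
open import Data.Sum using (_⊎_; inj₁; inj₂; [_,_]′)
import Data.Sum as Sum
open import Data.Sum.Function.Propositional using (_⊎-↔_)
open import Data.Unit using (tt)
open import Data.Empty using (⊥; ⊥-elim)
open import Function using (_∘_; id)
open import Function.Bundles using (_↔_; _⇔_; mk⇔; mk↔ₛ′; Equivalence; Injection)
open import Function.Construct.Composition using (_↔-∘_)
open import Function.Construct.Identity using (↔-id)
open import Function.Definitions using (Injective)
open import Function.Properties.Inverse using (↔⇒↣)
open import Relation.Nullary using (¬_; Dec; yes; no)
open import Relation.Nullary.Decidable using (map′; _×-dec_; ¬¬-excluded-middle)
open import Relation.Unary using (Decidable)
open import Relation.Binary.PropositionalEquality using (_≡_; refl; sym; trans; cong; cong₂; subst; module ≡-Reasoning)

module _ {X : Set} where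

  empty-finite : {A : Subset X} → (∀ x → ¬ A x) → Finite A
  empty-finite A-empty = [] , λ x a → ⊥-elim (A-empty x a)

  finite-⊆ : {A B : Subset X} → A ⊆ B → Finite B → Finite A
  finite-⊆ A⊆B (xs , B⊆xs) = xs , λ x a → B⊆xs x (A⊆B x a)

  finite-∪ : {A B : Subset X} → Finite A → Finite B → Finite (A ∪ B)
  finite-∪ (xs , A⊆xs) (ys , B⊆ys) = xs ++ ys , λ
    { x (inj₁ a) → ∈-++⁺ˡ (A⊆xs x a)
    ; x (inj₂ b) → ∈-++⁺ʳ xs (B⊆ys x b)
    }

ℕ-infinite : ¬ Finite {ℕ} full
ℕ-infinite (xs , full⊆xs) = 1+n≰n (lookupᴬ (xs≤max 0 xs) (full⊆xs (suc (max 0 xs)) tt))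

module _ {P : Set} where

  fibre : Subset (ℕ × P) → P → Subset ℕ
  fibre A p n = A (n , p)

  FiniteFibres : Subset (ℕ × P) → Subset P
  FiniteFibres A p = Finite (fibre A p)

  finite⇒finiteFibres : {A : Subset (ℕ × P)} → Finite A → ∀ p → FiniteFibres A p
  finite⇒finiteFibres (xs , A⊆xs) p = map proj₁ xs , λ n a → ∈-map⁺ proj₁ (A⊆xs (n , p) a)

  idealOver : Subset P → Ideal (ℕ × P)
  idealOver T = record
    { mem     = λ A → T ⊆ FiniteFibres A
    ; finite  = λ A A-finite p _ → finite⇒finiteFibres A-finite p
    ; union   = λ A B A-fin B-fin p t → finite-∪ (A-fin p t) (B-fin p t)
    ; subsets = λ A B A⊆B B-fin p t → finite-⊆ (λ n → A⊆B (n , p)) (B-fin p t)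
    }

  idealOver-proper : {T : Subset P} → ∃ T → Proper (idealOver T)
  idealOver-proper (p , t) full-fin = ℕ-infinite (full-fin p t)

  idealOver-incompatible : {S T : Subset P} → (∀ p → S p → T p → ⊥) →
                           Incompatible (idealOver S) (idealOver T)
  idealOver-incompatible {T = T} disjoint =
    (λ x → T (proj₂ x)) ,
    (λ p s → empty-finite λ _ t → disjoint p s t) ,
    (λ p t → empty-finite λ _ ¬t → ¬t t)

infix 2 _⊻_

_⊻_ : Set → Set → Set
P ⊻ Q = (P × ¬ Q) ⊎ (Q × ¬ P)

module _ {P Q : Set} where

  ⊻-map : ∀ {P′ Q′} → P ⇔ P′ → Q ⇔ Q′ → P ⊻ Q → P′ ⊻ Q′
  ⊻-map P⇔P′ Q⇔Q′ = Sum.map (Product.map (to P⇔P′) (_∘ from Q⇔Q′))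
                            (Product.map (to Q⇔Q′) (_∘ from P⇔P′))
    where open Equivalence

  ⊻-¬both : P ⊻ Q → P → Q → ⊥
  ⊻-¬both (inj₁ (_ , ¬q)) _ q = ¬q q
  ⊻-¬both (inj₂ (_ , ¬p)) p _ = ¬p p

  ⊻-¬neither : P ⊻ Q → ¬ P → ¬ Q → ⊥
  ⊻-¬neither (inj₁ (p , _)) ¬p _ = ¬p p
  ⊻-¬neither (inj₂ (q , _)) _ ¬q = ¬q q

data Tree : Set where
  leaf : Tree
  node : (m : ℕ) (l r : Tree) → Tree

data Leaf : Tree → Set where
  leaf  : Leaf leaf
  left  : ∀ {m l r} → Leaf l → Leaf (node m l r)
  right : ∀ {m l r} → Leaf r → Leaf (node m l r)

-- Each node m l r carries m copies of the pair (leaves of l , leaves of r).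
data Pair : Tree → Set where
  root  : ∀ {m l r} → Fin m → Pair (node m l r)
  left  : ∀ {m l r} → Pair l → Pair (node m l r)
  right : ∀ {m l r} → Pair r → Pair (node m l r)

data Side : Set where
  first second : Side

side : ∀ {t} → Side → Pair t → Subset (Leaf t)
side s (root _)  (left _)  = s ≡ first
side s (root _)  (right _) = s ≡ second
side s (left i)  (left x)  = side s i x
side s (left _)  (right _) = ⊥
side s (right _) (left _)  = ⊥
side s (right i) (right x) = side s i x

pairCount : Tree → ℕ
pairCount leaf         = 0
pairCount (node m l r) = pairCount l + (pairCount r + m)

enumeratePairs : ∀ t → Fin (pairCount t) ↔ Pair t
enumeratePairs leaf         = mk↔ₛ′ (λ ()) (λ ()) (λ ()) (λ ())
enumeratePairs (node m l r) =
  fromSum ↔-∘ ((enumeratePairs l ⊎-↔ ((enumeratePairs r ⊎-↔ ↔-id _) ↔-∘ +↔⊎)) ↔-∘ +↔⊎)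
  where
  toSum : Pair (node m l r) → Pair l ⊎ (Pair r ⊎ Fin m)
  toSum (left i)  = inj₁ i
  toSum (right i) = inj₂ (inj₁ i)
  toSum (root j)  = inj₂ (inj₂ j)

  fromSum : (Pair l ⊎ (Pair r ⊎ Fin m)) ↔ Pair (node m l r)
  fromSum = mk↔ₛ′ [ left , [ right , root ]′ ]′ toSum
    (λ { (left i) → refl ; (right i) → refl ; (root j) → refl })
    (λ { (inj₁ i) → refl ; (inj₂ (inj₁ i)) → refl ; (inj₂ (inj₂ j)) → refl })

someLeaf : ∀ t → Leaf t
someLeaf leaf         = leaf
someLeaf (node _ l _) = left (someLeaf l)

side-nonempty : ∀ {t} s (i : Pair t) → ∃ (side s i)
side-nonempty first  (root _)  = left (someLeaf _) , refl
side-nonempty second (root _)  = right (someLeaf _) , refl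
side-nonempty s      (left i)  = Product.map left id (side-nonempty s i)
side-nonempty s      (right i) = Product.map right id (side-nonempty s i)

sides-disjoint : ∀ {t} (i : Pair t) x → side first i x → side second i x → ⊥
sides-disjoint (root _)  (left _)  refl ()
sides-disjoint (root _)  (right _) ()
sides-disjoint (left i)  (left x)  = sides-disjoint i x
sides-disjoint (left _)  (right _) ()
sides-disjoint (right _) (left _)  ()
sides-disjoint (right i) (right x) = sides-disjoint i x

all? : ∀ {t} {F : Subset (Leaf t)} → Decidable F → Dec (∀ x → F x)
all? {leaf}       F? = map′ (λ f → λ { leaf → f }) (λ h → h leaf) (F? leaf)
all? {node _ _ _} F? =
  map′ (λ (fˡ , fʳ) → λ { (left x) → fˡ x ; (right x) → fʳ x }) (λ h → h ∘ left , h ∘ right)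
       (all? (F? ∘ left) ×-dec all? (F? ∘ right))

¬¬-decidable : ∀ {t} (F : Subset (Leaf t)) → ¬ ¬ Decidable F
¬¬-decidable {leaf}       F k = ¬¬-excluded-middle λ d → k λ { leaf → d }
¬¬-decidable {node _ _ _} F k =
  ¬¬-decidable (F ∘ left) λ dˡ → ¬¬-decidable (F ∘ right) λ dʳ →
    k λ { (left x) → dˡ x ; (right x) → dʳ x }

Cover : {A : Set} → Subset A → ℕ → Set
Cover {A} P c = Σ (List A) λ xs → length xs ≤ c × P ⊆ (_∈ xs)

module _ {A : Set} {P : Subset A} where

  cover-∅ : (∀ x → ¬ P x) → Cover P 0
  cover-∅ P-empty = [] , z≤n , λ x p → ⊥-elim (P-empty x p)

  cover-≤ : ∀ {c d} → c ≤ d → Cover P c → Cover P d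
  cover-≤ c≤d (xs , |xs|≤c , P⊆xs) = xs , ≤-trans |xs|≤c c≤d , P⊆xs

  cover-⊆ : ∀ {Q c} → P ⊆ Q → Cover Q c → Cover P c
  cover-⊆ P⊆Q (xs , |xs|≤c , Q⊆xs) = xs , |xs|≤c , λ x p → Q⊆xs x (P⊆Q x p)

cover-Fin : ∀ {m} {P : Subset (Fin m)} → Cover P m
cover-Fin {m} = allFin m , ≤-reflexive (length-tabulate id) , λ j _ → ∈-allFin j

cover-node : ∀ {m l r a b k} {P : Subset (Pair (node m l r))} →
             Cover (P ∘ left) a → Cover (P ∘ right) b → Cover (P ∘ root) k →
             Cover P (a + (b + k))
cover-node (xs , |xs|≤a , ⊆xs) (ys , |ys|≤b , ⊆ys) (zs , |zs|≤k , ⊆zs) =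
  map left xs ++ map right ys ++ map root zs ,
  ≤-trans (≤-reflexive length-eq) (+-mono-≤ |xs|≤a (+-mono-≤ |ys|≤b |zs|≤k)) ,
  λ { (left i)  p → ∈-++⁺ˡ (∈-map⁺ left (⊆xs i p))
    ; (right i) p → ∈-++⁺ʳ (map left xs) (∈-++⁺ˡ (∈-map⁺ right (⊆ys i p)))
    ; (root j)  p → ∈-++⁺ʳ (map left xs) (∈-++⁺ʳ (map right ys) (∈-map⁺ root (⊆zs j p)))
    }
  where
  open ≡-Reasoning
  length-eq : length (map left xs ++ map right ys ++ map root zs) ≡ length xs + (length ys + length zs)
  length-eq = begin
    length (map left xs ++ map right ys ++ map root zs)
      ≡⟨ length-++ (map left xs) ⟩
    length (map left xs) + length (map right ys ++ map root zs)
      ≡⟨ cong (length (map left xs) +_) (length-++ (map right ys)) ⟩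
    length (map left xs) + (length (map right ys) + length (map root zs))
      ≡⟨ cong₂ _+_ (length-map left xs) (cong₂ _+_ (length-map right ys) (length-map root zs)) ⟩
    length xs + (length ys + length zs) ∎

Separated : ∀ {t} → Subset (Leaf t) → Pair t → Set
Separated F i = side first i ⊆ F ⊻ side second i ⊆ F

SeparationBound : ℕ → Tree → Set₁
SeparationBound c t = (F : Subset (Leaf t)) → Decidable F → Cover (Separated F) c

module _ {m l r} {F : Subset (Leaf (node m l r))} where

  side-left-⊆ : ∀ s (i : Pair l) → side s (left i) ⊆ F ⇔ side s i ⊆ (F ∘ left)
  side-left-⊆ s i = mk⇔ (λ h x → h (left x)) (λ { h (left x) → h x ; h (right x) () })

  side-right-⊆ : ∀ s (i : Pair r) → side s (right i) ⊆ F ⇔ side s i ⊆ (F ∘ right)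
  side-right-⊆ s i = mk⇔ (λ h x → h (right x)) (λ { h (left x) () ; h (right x) → h x })

  first-root-⊆ : (j : Fin m) → side first (root j) ⊆ F ⇔ (∀ x → F (left x))
  first-root-⊆ j = mk⇔ (λ h x → h (left x) refl) (λ { h (left x) _ → h x ; h (right x) () })

  second-root-⊆ : (j : Fin m) → side second (root j) ⊆ F ⇔ (∀ x → F (right x))
  second-root-⊆ j = mk⇔ (λ h x → h (right x) refl) (λ { h (left x) () ; h (right x) _ → h x })

  separated-left : ∀ {i} → Separated F (left i) → Separated (F ∘ left) i
  separated-left {i} = ⊻-map (side-left-⊆ first i) (side-left-⊆ second i)

  separated-right : ∀ {i} → Separated F (right i) → Separated (F ∘ right) i
  separated-right {i} = ⊻-map (side-right-⊆ first i) (side-right-⊆ second i)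

  separated-root : ∀ {j} → Separated F (root j) → (∀ x → F (left x)) ⊻ (∀ x → F (right x))
  separated-root {j} = ⊻-map (first-root-⊆ j) (second-root-⊆ j)

separated⇒¬universal : ∀ {t} {F : Subset (Leaf t)} i → Separated F i → ¬ (∀ x → F x)
separated⇒¬universal _ (inj₁ (_ , second⊈F)) F-all = second⊈F λ x _ → F-all x
separated⇒¬universal _ (inj₂ (_ , first⊈F))  F-all = first⊈F λ x _ → F-all x

leaf-bound : ∀ {c} → SeparationBound c leaf
leaf-bound F F? = cover-≤ z≤n (cover-∅ λ ())

node-bound : ∀ {a b m l r} → SeparationBound a l → SeparationBound b r → m ≤ a → m ≤ b →
             SeparationBound (a + b) (node m l r)
node-bound {a} {b} bound-l bound-r m≤a m≤b F F? =
  by-cases (all? (F? ∘ left)) (all? (F? ∘ right))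
  where
  lefts : Cover (Separated F ∘ left) a
  lefts = cover-⊆ (λ _ → separated-left) (bound-l (F ∘ left) (F? ∘ left))

  rights : Cover (Separated F ∘ right) b
  rights = cover-⊆ (λ _ → separated-right) (bound-r (F ∘ right) (F? ∘ right))

  no-lefts : (∀ x → F (left x)) → Cover (Separated F ∘ left) 0
  no-lefts F-left = cover-∅ λ i s → separated⇒¬universal i (separated-left s) F-left

  no-rights : (∀ x → F (right x)) → Cover (Separated F ∘ right) 0
  no-rights F-right = cover-∅ λ i s → separated⇒¬universal i (separated-right s) F-right

  by-cases : Dec (∀ x → F (left x)) → Dec (∀ x → F (right x)) → Cover (Separated F) (a + b)
  by-cases (yes F-left) (yes F-right) = cover-≤ z≤n
    (cover-node (no-lefts F-left) (no-rights F-right)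
                (cover-∅ λ _ s → ⊻-¬both (separated-root s) F-left F-right))
  by-cases (yes F-left) (no _) = cover-≤ (≤-trans (+-monoʳ-≤ b m≤a) (≤-reflexive (+-comm b a)))
    (cover-node (no-lefts F-left) rights cover-Fin)
  by-cases (no _) (yes F-right) = cover-≤ (+-monoʳ-≤ a m≤b)
    (cover-node lefts (no-rights F-right) cover-Fin)
  by-cases (no F-left) (no F-right) = cover-≤ (≤-reflexive (cong (a +_) (+-identityʳ b)))
    (cover-node lefts rights (cover-∅ λ _ s → ⊻-¬neither (separated-root s) F-left F-right))

^-distribʳ-* : ∀ a b n → (a * b) ^ n ≡ a ^ n * b ^ n
^-distribʳ-* a b zero    = refl
^-distribʳ-* a b (suc n) = begin
  a * b * (a * b) ^ n       ≡⟨ cong (a * b *_) (^-distribʳ-* a b n) ⟩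
  a * b * (a ^ n * b ^ n)   ≡⟨ interchange a b (a ^ n) (b ^ n) ⟩
  a * a ^ n * (b * b ^ n)   ∎
  where
  open ≡-Reasoning
  interchange : ∀ a b x y → a * b * (x * y) ≡ a * x * (b * y)
  interchange = solve-∀

bernoulli : ∀ a j → a ^ suc j + suc j * a ^ j ≤ suc a ^ suc j
bernoulli a zero    = ≤-reflexive (base a)
  where
  base : ∀ a → a * 1 + 1 * 1 ≡ suc a * 1
  base = solve-∀
bernoulli a (suc j) = begin
  a ^ suc (suc j) + suc (suc j) * a ^ suc j                  ≤⟨ m≤m+n _ (suc j * a ^ j) ⟩
  a ^ suc (suc j) + suc (suc j) * a ^ suc j + suc j * a ^ j  ≡⟨ expand a (a ^ j) j ⟩
  suc a * (a ^ suc j + suc j * a ^ j)                        ≤⟨ *-monoʳ-≤ (suc a) (bernoulli a j) ⟩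
  suc a * suc a ^ suc j                                      ∎
  where
  open ≤-Reasoning
  expand : ∀ a x j → a * (a * x) + suc (suc j) * (a * x) + suc j * x ≡ suc a * (a * x + suc j * x)
  expand = solve-∀

Large : ℕ → ℕ → Set
Large c K = suc c ^ c ≤ 2 ^ (2 * K + c)

even-power-bound : ∀ m → suc (m + m) ^ (m + m) ≤ 2 ^ (m + m) * (suc m ^ m * suc m ^ m)
even-power-bound m = begin
  suc (m + m) ^ (m + m)                  ≤⟨ ^-monoˡ-≤ (m + m) (≤-trans (n≤1+n _) (≤-reflexive (double m))) ⟩
  (2 * suc m) ^ (m + m)                  ≡⟨ ^-distribʳ-* 2 (suc m) (m + m) ⟩
  2 ^ (m + m) * suc m ^ (m + m)          ≡⟨ cong (2 ^ (m + m) *_) (^-distribˡ-+-* (suc m) m m) ⟩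
  2 ^ (m + m) * (suc m ^ m * suc m ^ m)  ∎
  where
  open ≤-Reasoning
  double : ∀ m → suc (suc (m + m)) ≡ 2 * suc m
  double = solve-∀

-- (2m+2)^(2m+1) = 2^(2m) (m+1)^m · 2 (m+1)^(m+1), and 2 (m+1)^(m+1) ≤ (m+2)^(m+1) by Bernoulli.
odd-power-bound : ∀ m → suc (suc (m + m)) ^ suc (m + m) ≤ 2 ^ (m + m) * (suc m ^ m * suc (suc m) ^ suc m)
odd-power-bound m = begin
  suc (suc (m + m)) ^ suc (m + m)             ≡⟨ cong (_^ suc (m + m)) (double m) ⟩
  (2 * suc m) ^ suc (m + m)                   ≡⟨ ^-distribʳ-* 2 (suc m) (suc (m + m)) ⟩
  2 ^ suc (m + m) * (suc m * suc m ^ (m + m)) ≡⟨ cong (λ y → 2 ^ suc (m + m) * (suc m * y)) (^-distribˡ-+-* (suc m) m m) ⟩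
  2 * p * (suc m * (y * y))                   ≡⟨ rearrange p (suc m) y ⟩
  p * (y * (suc m * y + suc m * y))           ≤⟨ *-monoʳ-≤ p (*-monoʳ-≤ y (bernoulli (suc m) m)) ⟩
  p * (y * suc (suc m) ^ suc m)               ∎
  where
  open ≤-Reasoning
  p = 2 ^ (m + m)
  y = suc m ^ m
  double : ∀ m → suc (suc (m + m)) ≡ 2 * suc m
  double = solve-∀
  rearrange : ∀ p x y → 2 * p * (x * (y * y)) ≡ p * (y * (x * y + x * y))
  rearrange = solve-∀

large-node : ∀ {a b m K₁ K₂} → Large a K₁ → Large b K₂ →
             suc (a + b) ^ (a + b) ≤ 2 ^ (m + m) * (suc a ^ a * suc b ^ b) →
             Large (a + b) (K₁ + (K₂ + m))
large-node {a} {b} {m} {K₁} {K₂} large₁ large₂ power-bound = begin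
  suc (a + b) ^ (a + b)                                ≤⟨ power-bound ⟩
  2 ^ (m + m) * (suc a ^ a * suc b ^ b)                ≤⟨ *-monoʳ-≤ (2 ^ (m + m)) (*-mono-≤ large₁ large₂) ⟩
  2 ^ (m + m) * (2 ^ (2 * K₁ + a) * 2 ^ (2 * K₂ + b))  ≡⟨ cong (2 ^ (m + m) *_) (sym (^-distribˡ-+-* 2 (2 * K₁ + a) (2 * K₂ + b))) ⟩
  2 ^ (m + m) * 2 ^ (2 * K₁ + a + (2 * K₂ + b))        ≡⟨ sym (^-distribˡ-+-* 2 (m + m) _) ⟩
  2 ^ (m + m + (2 * K₁ + a + (2 * K₂ + b)))            ≡⟨ cong (2 ^_) (exponent m K₁ K₂ a b) ⟩
  2 ^ (2 * (K₁ + (K₂ + m)) + (a + b))                  ∎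
  where
  open ≤-Reasoning
  exponent : ∀ m K₁ K₂ a b → m + m + (2 * K₁ + a + (2 * K₂ + b)) ≡ 2 * (K₁ + (K₂ + m)) + (a + b)
  exponent = solve-∀

record BoundedTree (c : ℕ) : Set₁ where
  field
    tree  : Tree
    bound : SeparationBound c tree
    large : Large c (pairCount tree)

leaf-tree : ∀ {c} → Large c 0 → BoundedTree c
leaf-tree large = record { tree = leaf ; bound = leaf-bound ; large = large }

node-tree : ∀ {a b c} m → BoundedTree a → BoundedTree b → m ≤ a → m ≤ b →
            suc c ^ c ≤ 2 ^ (m + m) * (suc a ^ a * suc b ^ b) → a + b ≡ c → BoundedTree c
node-tree {a} {b} m T₁ T₂ m≤a m≤b power-bound refl = record
  { tree  = node m (tree T₁) (tree T₂)
  ; bound = node-bound (bound T₁) (bound T₂) m≤a m≤b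
  ; large = large-node {a} {b} {m} {pairCount (tree T₁)} {pairCount (tree T₂)}
                       (large T₁) (large T₂) power-bound
  }
  where open BoundedTree

data Parity : ℕ → Set where
  even : ∀ m → Parity (m + m)
  odd  : ∀ m → Parity (suc (m + m))

parity : ∀ n → Parity n
parity zero = even 0
parity (suc n) with parity n
... | even m = odd m
... | odd m  = subst Parity (cong suc (+-suc m m)) (even (suc m))

-- c = ⌊c/2⌋ + ⌈c/2⌉, joined by ⌊c/2⌋ copies of the root pair; for c ≤ 1 a single leaf is large enough.
boundedTree : ∀ c → BoundedTree c
boundedTree = <-rec BoundedTree build
  where
  build : ∀ c → (∀ {c′} → c′ < c → BoundedTree c′) → BoundedTree c
  build c rec with parity c
  ... | even zero    = leaf-tree ≤-refl
  ... | odd zero     = leaf-tree ≤-refl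
  ... | even (suc m) =
    node-tree (suc m) (rec (m<m+n (suc m) z<s)) (rec (m<m+n (suc m) z<s))
              ≤-refl ≤-refl (even-power-bound (suc m)) refl
  ... | odd (suc m)  =
    node-tree (suc m) (rec (s≤s (m≤m+n (suc m) (suc m)))) (rec (s≤s (s≤s (m≤n+m (suc m) m))))
              ≤-refl (n≤1+n _) (odd-power-bound (suc m)) (+-suc (suc m) (suc m))

Works-mono : ∀ {n k K} → k ≤ K → Works n k → Works n K
Works-mono {_} {k} {K} k≤K works X I J I-proper J-proper incompatible =
  let A , f , f-injective , chooses = works X (I ∘ ι) (J ∘ ι) (I-proper ∘ ι) (J-proper ∘ ι) (incompatible ∘ ι)
  in A , ι ∘ f , (λ eq → f-injective (inject≤-injective k≤K k≤K _ _ eq)) , chooses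
  where
  ι : Fin k → Fin K
  ι i = inject≤ i k≤K

injective⇒≤length : ∀ {A : Set} {n} {xs : List A} (g : Fin n → A) →
                    Injective _≡_ _≡_ g → (∀ j → g j ∈ xs) → n ≤ length xs
injective⇒≤length {xs = xs} g g-injective g∈xs = injective⇒≤ λ {i} {j} eq →
  g-injective (trans (lookup-index (g∈xs i)) (trans (cong (lookup xs) eq) (sym (lookup-index (g∈xs j)))))

-- For the ideals of the two sides of a pair, Chooses A unfolds to Separated (FiniteFibres A).
separationBound⇒¬Works : ∀ {c} t → SeparationBound c t → ¬ Works (suc c) (pairCount t)
separationBound⇒¬Works t bound works =
  let A , f , f-injective , chooses =
        works (ℕ × Leaf t) (ideals first) (ideals second) (proper first) (proper second) incompatible
  in ¬¬-decidable (FiniteFibres A) λ finite? →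
    let L , |L|≤c , separated∈L = bound (FiniteFibres A) finite?
    in 1+n≰n (≤-trans (injective⇒≤length (pair ∘ f) (f-injective ∘ pair-injective)
                                         (λ j → separated∈L _ (chooses j)))
                      |L|≤c)
  where
  open Injection (↔⇒↣ (enumeratePairs t)) renaming (to to pair; injective to pair-injective)

  ideals : Side → Fin (pairCount t) → Ideal (ℕ × Leaf t)
  ideals s = idealOver ∘ side s ∘ pair

  proper : ∀ s i → Proper (ideals s i)
  proper s i = idealOver-proper (side-nonempty s (pair i))

  incompatible : ∀ i → Incompatible (ideals first i) (ideals second i)
  incompatible i = idealOver-incompatible (sides-disjoint (pair i))

e*-bound⇒≤ : ∀ {c K k} → Large c K → e* (2 ^ (2 * k + suc c)) ≤ (16 * suc c ^ c) → k ≤ K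
e*-bound⇒≤ {c} {K} {k} large e-bound = ≮⇒≥ λ K<k →
  <⇒≱ (*-monoʳ-< x {{m^n≢0 2 (2 * K + c)}} (s≤s (m≤m+n 32 7))) (begin
    x * 40                         ≡⟨ times-40 x ⟩
    2 ^ 3 * x * 5                  ≡⟨ cong (_* 5) (sym (^-distribˡ-+-* 2 3 (2 * K + c))) ⟩
    2 ^ (3 + (2 * K + c)) * 5      ≡⟨ cong (λ e → 2 ^ e * 5) (exponent K c) ⟩
    2 ^ (2 * suc K + suc c) * 5    ≤⟨ *-monoˡ-≤ 5 (^-monoʳ-≤ 2 (+-monoˡ-≤ (suc c) (*-monoʳ-≤ 2 K<k))) ⟩
    2 ^ (2 * k + suc c) * 5        ≤⟨ e-bound 2 ⟩
    16 * suc c ^ c * 2             ≤⟨ *-monoˡ-≤ 2 (*-monoʳ-≤ 16 large) ⟩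
    16 * x * 2                     ≡⟨ times-32 x ⟩
    x * 32                         ∎)
  where
  open ≤-Reasoning
  x : ℕ
  x = 2 ^ (2 * K + c)
  times-40 : ∀ x → x * 40 ≡ 8 * x * 5
  times-40 = solve-∀
  times-32 : ∀ x → 16 * x * 2 ≡ x * 32
  times-32 = solve-∀
  exponent : ∀ K c → 3 + (2 * K + c) ≡ 2 * suc K + suc c
  exponent = solve-∀

mainTheorem12 : (n : ℕ) → 1 ≤ n → (k : ℕ) →
    e* (2 ^ (2 * k + n)) ≤ (16 * n ^ (n ∸ 1)) → ¬ Works n k
mainTheorem12 (suc c) _ k e-bound =
  separationBound⇒¬Works tree bound ∘ Works-mono (e*-bound⇒≤ large e-bound)
  where open BoundedTree (boundedTree c)
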